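{- Let $k$ be a positive integer, $p$ a prime, and $\mathcal F\subset 2^{[n]}$ a full-support $k$-wise $p$-divisible family. Let $V$ be the $\mathbb F_p$-span of the characteristic vectors of members of $\mathcal F$. Suppose $V^{\langle k\rangle}=C_1\oplus C_2$ where $C_1,C_2\subset\mathbb F_p^n$ are codes with disjoint non-empty supports $S_1,S_2$ such that $[n]=S_1\cup S_2$. Let $\mathcal F_i=\{F\cap S_i: F\in\mathcal F\}$ for $i=1,2$. Then $\mathcal F_1$ and $\mathcal F_2$ are $k$-wise $p$-divisible, and $|\mathcal F|\le|\mathcal F_1||\mathcal F_2|$.
   Context: Full support: the union of the members of $\mathcal F$ is $[n]$. $k$-wise $p$-divisible: $|A_1\cap\cdots\cap A_k|\equiv0\pmod p$ for all (not necessarily distinct) $A_1,\dots,A_k$ in the family. The support of a code $C\subset\mathbb F_p^n$ is the set of coordinates $i$ such that $v(i)\ne0$ for some $v\in C$. For subspaces $C,D$, $CD$ is the span of coordinatewise products; $V^{\langle 1\rangle}=V$, $V^{\langle i\rangle}=V^{\langle i-1\rangle}V$. -}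

module Defs where

open import Data.Nat using (ℕ; zero; suc; _+_; _*_)
open import Data.Nat.Divisibility using (_∣_)
open import Data.Bool using (Bool; true; false; if_then_else_)
import Data.Bool.Properties as BoolP
open import Data.Fin using (Fin)
open import Data.Fin.Subset using (Subset; _∩_; _∈_; ⊤; ∣_∣)
open import Data.Vec using (Vec; lookup; foldr)
import Data.Vec.Properties as VecP
open import Data.List using (List; []; _∷_; length; map; deduplicate)
open import Data.List.Relation.Unary.All using (All)
import Data.List.Membership.Propositional as LM
open import Data.Product using (Σ; _×_; ∃; _,_)
open import Relation.Nullary using (¬_)
open import Relation.Binary.PropositionalEquality using (_≡_)
open import Function.Bundles using (_⇔_)

-- Elements of F_p are represented by natural numbers, compared modulo p.
-- a ≡ b (mod p)
Cong : ℕ → ℕ → ℕ → Set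
Cong p a b = Σ ℕ λ q → Σ ℕ λ r → a + q * p ≡ b + r * p

Vecₚ : ℕ → Set
Vecₚ n = Fin n → ℕ

_≈[_]_ : ∀ {n} → Vecₚ n → ℕ → Vecₚ n → Set
x ≈[ p ] y = ∀ i → Cong p (x i) (y i)

zeroV : ∀ {n} → Vecₚ n
zeroV i = 0

_+V_ : ∀ {n} → Vecₚ n → Vecₚ n → Vecₚ n
(x +V y) i = x i + y i

_·V_ : ∀ {n} → ℕ → Vecₚ n → Vecₚ n
(c ·V x) i = c * x i

_⊙_ : ∀ {n} → Vecₚ n → Vecₚ n → Vecₚ n
(x ⊙ y) i = x i * y i

Code : ℕ → Set₁
Code n = Vecₚ n → Set

-- C is an F_p-linear subspace of F_p^n (and a well-defined subset of F_p^n,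
-- i.e. closed under congruence mod p)
record IsSubspace (p : ℕ) {n : ℕ} (C : Code n) : Set where
  field
    resp   : ∀ {x y} → x ≈[ p ] y → C x → C y
    has0   : C zeroV
    closed+ : ∀ {x y} → C x → C y → C (x +V y)
    closed· : ∀ c {x} → C x → C (c ·V x)

Span : ∀ {n} → ℕ → List (Vecₚ n) → Code n
Span {n} p gens x = Σ (List ℕ) λ cs → length cs ≡ length gens × x ≈[ p ] comb cs gens
  where
  comb : List ℕ → List (Vecₚ n) → Vecₚ n
  comb (c ∷ cs) (g ∷ gs) = (c ·V g) +V comb cs gs
  comb _ _ = zeroV

sumProd : ∀ {n} → List (ℕ × Vecₚ n × Vecₚ n) → Vecₚ n
sumProd [] = zeroV
sumProd ((c , u , v) ∷ ts) = (c ·V (u ⊙ v)) +V sumProd ts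

_·C_ : ∀ {n} → Code n → Code n → ℕ → Code n
(C ·C D) p x = Σ (List (ℕ × Vecₚ _ × Vecₚ _)) λ ts →
  All (λ { (c , u , v) → C u × D v }) ts × x ≈[ p ] sumProd ts

-- V^⟨i⟩ for i ≥ 1 (V^⟨1⟩ = V, V^⟨i⟩ = V^⟨i-1⟩ V); the value at 0 is unused
Pow : ∀ {n} → ℕ → Code n → ℕ → Code n
Pow p V zero = V
Pow p V (suc zero) = V
Pow p V (suc (suc i)) = (Pow p V (suc i) ·C V) p

record DirectSum (p : ℕ) {n : ℕ} (W C₁ C₂ : Code n) : Set where
  field
    sub₁ : ∀ {x} → C₁ x → W x
    sub₂ : ∀ {x} → C₂ x → W x
    decomp : ∀ {x} → W x → Σ (Vecₚ n) λ a → Σ (Vecₚ n) λ b → C₁ a × C₂ b × x ≈[ p ] (a +V b)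
    trivial∩ : ∀ {x} → C₁ x → C₂ x → x ≈[ p ] zeroV

InSupport : ∀ {n} → ℕ → Code n → Fin n → Set
InSupport p C i = ∃ λ v → C v × ¬ Cong p (v i) 0

χ : ∀ {n} → Subset n → Vecₚ n
χ A i = if lookup A i then 1 else 0

Family : ℕ → Set
Family n = List (Subset n)

⋂ : ∀ {n k} → Vec (Subset n) k → Subset n
⋂ = foldr _ _∩_ ⊤

-- k-wise p-divisible (A₁, …, Aₖ not necessarily distinct)
KWiseDivisible : ∀ {n} → ℕ → ℕ → Family n → Set
KWiseDivisible {n} k p 𝓕 = (As : Vec (Subset n) k) →
  Data.Vec.Relation.Unary.All.All (LM._∈ 𝓕) As → p ∣ ∣ ⋂ As ∣
  where import Data.Vec.Relation.Unary.All

FullSupport : ∀ {n} → Family n → Set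
FullSupport {n} 𝓕 = ∀ (i : Fin n) → ∃ λ A → A LM.∈ 𝓕 × i ∈ A

card : ∀ {n} → Family n → ℕ
card 𝓕 = length (deduplicate (VecP.≡-dec BoolP._≟_) 𝓕)

restrict : ∀ {n} → Family n → Subset n → Family n
restrict 𝓕 S = map (_∩ S) 𝓕

charSpan : ∀ {n} → ℕ → Family n → Code n
charSpan p 𝓕 = Span p (map χ 𝓕)

{-# OPTIONS --safe #-}
module Submission where

-- Moving one factor χ F of a product u ⊙ χ F to the other side of the dot product shows, by
-- induction on j, that every vector of V^⟨j+1⟩ is orthogonal mod p to χ(A₁ ∩ ⋯ ∩ Aₘ) for all
-- A₁, …, Aₘ ∈ 𝓕 as soon as 𝓕 is (j+1+m)-wise divisible; for m = 0, every vector of V^⟨k⟩ has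
-- coordinate sum divisible by p. For F₁, …, F_k ∈ 𝓕 the vector χ(F₁ ∩ ⋯ ∩ F_k) lies in V^⟨k⟩, and
-- since C₁ and C₂ live on the disjoint sets S₁ and S₂, its C₁-component is χ(F₁ ∩ ⋯ ∩ F_k ∩ S₁).
-- That component lies in V^⟨k⟩ as well, so p divides |F₁ ∩ ⋯ ∩ F_k ∩ S₁|. The bound on |𝓕| holds
-- because F ↦ (F ∩ S₁, F ∩ S₂) is injective when S₁ ∪ S₂ = [n].

open import Defs
open import Data.Nat using (ℕ; _≤_; _*_)
open import Data.Nat.Primality using (Prime)
open import Data.Fin using (Fin)
open import Data.Fin.Subset using (Subset; _∈_; _∉_)
open import Data.Product using (_×_; ∃)
open import Data.Sum using (_⊎_)
open import Function.Bundles using (_⇔_)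

open import Algebra.Bundles using (CommutativeMonoid)
import Algebra.Properties.CommutativeSemigroup as CommutativeSemigroupProperties
open import Data.Bool using (true; false)
import Data.Bool.Properties as Bool
open import Data.Fin using (zero; suc)
open import Data.Fin.Subset using (_∩_; _∪_; ⊤; ∣_∣)
open import Data.Fin.Subset.Properties
  using (_∈?_; ∈⊤; ⊆⊤; ⊆-antisym; p⊆p∪q; q⊆p∪q; ∩-identityʳ; ∩-idem; ∩-distribˡ-∪; ∩-commutativeMonoid)
open import Data.List using (List; []; _∷_; length; deduplicate; cartesianProduct)
import Data.List as List
open import Data.List.Membership.Propositional using () renaming (_∈_ to _∈ˡ_; _─_ to _─ˡ_)
open import Data.List.Membership.Propositional.Properties
  using (∈-map⁺; ∈-map⁻; ∈-deduplicate⁺; ∈-deduplicate⁻; ∈-cartesianProduct⁺)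
open import Data.List.Properties using (length-map; length-++; length-removeAt′)
import Data.List.Relation.Unary.All as ListAll
open import Data.List.Relation.Unary.Any using (here; there; index)
open import Data.List.Relation.Unary.AllPairs using (_∷_)
open import Data.List.Relation.Unary.Unique.Propositional using (Unique)
import Data.List.Relation.Unary.Unique.Propositional.Properties as Unique
open import Data.List.Relation.Unary.Unique.DecPropositional.Properties using (deduplicate-!)
open import Data.Nat using (zero; suc; _+_; s≤s; z≤n)
open import Data.Nat.Divisibility using (_∣_; divides; _∣?_; _∣0; n∣m*n; ∣m∣n⇒∣m+n; ∣m+n∣m⇒∣n; ∣n⇒∣m*n)
open import Data.Nat.Properties
  using (+-comm; +-suc; +-identityʳ; *-comm; *-assoc; *-identityˡ; *-identityʳ; *-zeroʳ; *-distribʳ-+;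
         suc-injective; +-*-semiring; module ≤-Reasoning)
open import Data.Nat.Tactic.RingSolver using (solve-∀)
open import Algebra.Properties.Semiring.Sum +-*-semiring
  using (sum; sum-cong-≗; ∑-distrib-+; *-distribˡ-sum; sum-replicate-zero)
open import Data.Product using (_,_; proj₁; proj₂)
open import Data.Sum using ([_,_])
open import Data.Vec using (Vec; []; _∷_; here; there)
import Data.Vec as Vec
import Data.Vec.Properties as VecProperties
import Data.Vec.Relation.Unary.All as VecAll
open import Function using (_∘_)
open import Function.Bundles using (Equivalence)
open import Relation.Binary.Bundles using (Setoid)
open import Relation.Binary.Structures using (IsEquivalence)
import Relation.Binary.Reasoning.Setoid as SetoidReasoning
open import Relation.Binary.PropositionalEquality
  using (_≡_; _≢_; refl; sym; trans; cong; cong₂; subst; _≗_; module ≡-Reasoning)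
open import Relation.Nullary using (¬_; yes; no; contradiction)

private
  variable
    n : ℕ

module _ {p : ℕ} where

  Cong-refl : ∀ {a} → Cong p a a
  Cong-refl = 0 , 0 , refl

  Cong-sym : ∀ {a b} → Cong p a b → Cong p b a
  Cong-sym (q , r , e) = r , q , sym e

  Cong-trans : ∀ {a b c} → Cong p a b → Cong p b c → Cong p a c
  Cong-trans {a} {b} {c} (q , r , e) (s , t , f) = q + s , t + r , (begin
    a + (q + s) * p       ≡⟨ split a q s p ⟩
    (a + q * p) + s * p   ≡⟨ cong (_+ s * p) e ⟩
    (b + r * p) + s * p   ≡⟨ swap b (r * p) (s * p) ⟩
    (b + s * p) + r * p   ≡⟨ cong (_+ r * p) f ⟩
    (c + t * p) + r * p   ≡⟨ split c t r p ⟨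
    c + (t + r) * p       ∎)
    where
    open ≡-Reasoning
    split : ∀ x u v p → x + (u + v) * p ≡ (x + u * p) + v * p
    split = solve-∀
    swap : ∀ x y z → (x + y) + z ≡ (x + z) + y
    swap = solve-∀

  Cong-isEquivalence : IsEquivalence (Cong p)
  Cong-isEquivalence = record { refl = Cong-refl ; sym = Cong-sym ; trans = Cong-trans }

  ≡⇒Cong : ∀ {a b} → a ≡ b → Cong p a b
  ≡⇒Cong refl = Cong-refl

  Cong-+ : ∀ {a b c d} → Cong p a b → Cong p c d → Cong p (a + c) (b + d)
  Cong-+ {a} {b} {c} {d} (q , r , e) (s , t , f) = q + s , r + t , (begin
    (a + c) + (q + s) * p         ≡⟨ shuffle a c q s p ⟩
    (a + q * p) + (c + s * p)     ≡⟨ cong₂ _+_ e f ⟩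
    (b + r * p) + (d + t * p)     ≡⟨ shuffle b d r t p ⟨
    (b + d) + (r + t) * p         ∎)
    where
    open ≡-Reasoning
    shuffle : ∀ x y u v p → (x + y) + (u + v) * p ≡ (x + u * p) + (y + v * p)
    shuffle = solve-∀

  Cong-*ʳ : ∀ c {a b} → Cong p a b → Cong p (a * c) (b * c)
  Cong-*ʳ c {a} {b} (q , r , e) = q * c , r * c , (begin
    a * c + (q * c) * p   ≡⟨ factor a q c p ⟩
    (a + q * p) * c       ≡⟨ cong (_* c) e ⟩
    (b + r * p) * c       ≡⟨ factor b r c p ⟨
    b * c + (r * c) * p   ∎)
    where
    open ≡-Reasoning
    factor : ∀ x u c p → x * c + (u * c) * p ≡ (x + u * p) * c
    factor = solve-∀

  Cong-resp-∣ : ∀ {a b} → Cong p a b → p ∣ a → p ∣ b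
  Cong-resp-∣ {a} {b} (q , r , e) p∣a =
    ∣m+n∣m⇒∣n (subst (p ∣_) (trans e (+-comm b (r * p))) (∣m∣n⇒∣m+n p∣a (n∣m*n q))) (n∣m*n r)

  ∣⇒Cong0 : ∀ {a} → p ∣ a → Cong p a 0
  ∣⇒Cong0 {a} (divides q a≡q*p) = 0 , q , trans (+-identityʳ a) a≡q*p

  ≈-sym : {x y : Vecₚ n} → x ≈[ p ] y → y ≈[ p ] x
  ≈-sym x≈y i = Cong-sym (x≈y i)

  sum-Cong : ∀ {m} {f g : Fin m → ℕ} → (∀ i → Cong p (f i) (g i)) → Cong p (sum f) (sum g)
  sum-Cong {zero} f≈g = Cong-refl
  sum-Cong {suc m} f≈g = Cong-+ (f≈g zero) (sum-Cong (f≈g ∘ suc))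

Cong-setoid : ℕ → Setoid _ _
Cong-setoid p = record { Carrier = ℕ ; _≈_ = Cong p ; isEquivalence = Cong-isEquivalence }

χ-∈ : ∀ {S : Subset n} {i} → i ∈ S → χ S i ≡ 1
χ-∈ here = refl
χ-∈ (there i∈S) = χ-∈ i∈S

χ-∉ : ∀ {S : Subset n} {i} → i ∉ S → χ S i ≡ 0
χ-∉ {S = true ∷ _} {i = zero} i∉S = contradiction here i∉S
χ-∉ {S = false ∷ _} {i = zero} i∉S = refl
χ-∉ {S = _ ∷ _} {i = suc _} i∉S = χ-∉ (i∉S ∘ there)

χ-∩ : ∀ (A B : Subset n) → χ (A ∩ B) ≗ χ A ⊙ χ B
χ-∩ (true ∷ A) (true ∷ B) zero = refl
χ-∩ (true ∷ A) (false ∷ B) zero = refl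
χ-∩ (false ∷ A) (_ ∷ B) zero = refl
χ-∩ (_ ∷ A) (_ ∷ B) (suc i) = χ-∩ A B i

∣∣≡sum-χ : ∀ (A : Subset n) → ∣ A ∣ ≡ sum (χ A)
∣∣≡sum-χ [] = refl
∣∣≡sum-χ (true ∷ A) = cong suc (∣∣≡sum-χ A)
∣∣≡sum-χ (false ∷ A) = ∣∣≡sum-χ A

⋂-map-∩ : ∀ {j} (S : Subset n) (Fs : Vec (Subset n) (suc j)) → ⋂ (Vec.map (_∩ S) Fs) ≡ ⋂ Fs ∩ S
⋂-map-∩ S (F ∷ []) = begin
  (F ∩ S) ∩ ⊤   ≡⟨ ∩-identityʳ (F ∩ S) ⟩
  F ∩ S         ≡⟨ cong (_∩ S) (∩-identityʳ F) ⟨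
  (F ∩ ⊤) ∩ S   ∎
  where open ≡-Reasoning
⋂-map-∩ S (F ∷ G ∷ Fs) = begin
  (F ∩ S) ∩ ⋂ (Vec.map (_∩ S) (G ∷ Fs))   ≡⟨ cong ((F ∩ S) ∩_) (⋂-map-∩ S (G ∷ Fs)) ⟩
  (F ∩ S) ∩ (X ∩ S)                        ≡⟨ interchange F S X S ⟩
  (F ∩ X) ∩ (S ∩ S)                        ≡⟨ cong ((F ∩ X) ∩_) (∩-idem S) ⟩
  (F ∩ X) ∩ S                              ∎
  where
  open ≡-Reasoning
  open CommutativeSemigroupProperties (CommutativeMonoid.commutativeSemigroup (∩-commutativeMonoid _))
  X = ⋂ (G ∷ Fs)

All∈map⁻ : ∀ {A B : Set} {f : A → B} {xs : List A} {k} (ys : Vec B k) → VecAll.All (_∈ˡ List.map f xs) ys →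
           ∃ λ (zs : Vec A k) → VecAll.All (_∈ˡ xs) zs × ys ≡ Vec.map f zs
All∈map⁻ [] VecAll.[] = [] , VecAll.[] , refl
All∈map⁻ (y ∷ ys) (y∈ VecAll.∷ ys∈) with ∈-map⁻ _ y∈ | All∈map⁻ ys ys∈
... | z , z∈ , refl | zs , zs∈ , refl = z ∷ zs , z∈ VecAll.∷ zs∈ , refl

KWiseDivisible-restrict : ∀ {k p} (𝓕 : Family n) (S : Subset n) → 1 ≤ k →
  (∀ (Fs : Vec (Subset n) k) → VecAll.All (_∈ˡ 𝓕) Fs → p ∣ ∣ ⋂ Fs ∩ S ∣) →
  KWiseDivisible k p (restrict 𝓕 S)
KWiseDivisible-restrict {p = p} 𝓕 S (s≤s z≤n) meets As As∈ with All∈map⁻ As As∈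
... | Fs , Fs∈ , refl = subst (λ X → p ∣ ∣ X ∣) (sym (⋂-map-∩ S Fs)) (meets Fs Fs∈)

infix 7 _·_
_·_ : Vecₚ n → Vecₚ n → ℕ
x · y = sum (x ⊙ y)

·-congʳ : ∀ (x : Vecₚ n) {y z} → y ≗ z → x · y ≡ x · z
·-congʳ x y≗z = sum-cong-≗ (λ i → cong (x i *_) (y≗z i))

·-cong-≈ : ∀ {p} (w : Vecₚ n) {x y} → x ≈[ p ] y → Cong p (x · w) (y · w)
·-cong-≈ w x≈y = sum-Cong (λ i → Cong-*ʳ (w i) (x≈y i))

·-distribʳ-+V : ∀ (x y w : Vecₚ n) → (x +V y) · w ≡ x · w + y · w
·-distribʳ-+V x y w = trans (sum-cong-≗ (λ i → *-distribʳ-+ (w i) (x i) (y i))) (∑-distrib-+ (x ⊙ w) (y ⊙ w))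

·V-· : ∀ c (x w : Vecₚ n) → (c ·V x) · w ≡ c * (x · w)
·V-· c x w = trans (sum-cong-≗ (λ i → *-assoc c (x i) (w i))) (sym (*-distribˡ-sum c (x ⊙ w)))

⊙-·-swap : ∀ (u v w : Vecₚ n) → (u ⊙ v) · w ≡ v · (u ⊙ w)
⊙-·-swap u v w = sum-cong-≗ (λ i → rearrange (u i) (v i) (w i))
  where
  rearrange : ∀ a b c → (a * b) * c ≡ b * (a * c)
  rearrange = solve-∀

·-⊙-swap : ∀ (u v w : Vecₚ n) → u · (v ⊙ w) ≡ v · (u ⊙ w)
·-⊙-swap u v w = sum-cong-≗ (λ i → rearrange (u i) (v i) (w i))
  where
  rearrange : ∀ a b c → a * (b * c) ≡ b * (a * c)
  rearrange = solve-∀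

χ-·-χ : ∀ (A B : Subset n) → χ A · χ B ≡ ∣ A ∩ B ∣
χ-·-χ A B = trans (sum-cong-≗ (sym ∘ χ-∩ A B)) (sym (∣∣≡sum-χ (A ∩ B)))

·-χ⊤ : ∀ (x : Vecₚ n) → x · χ ⊤ ≡ sum x
·-χ⊤ {n} x = sum-cong-≗ (λ i → trans (cong (x i *_) (χ-∈ {S = ⊤ {n}} (∈⊤ {x = i}))) (*-identityʳ (x i)))

Orthogonal : ℕ → Vecₚ n → Code n
Orthogonal p w x = p ∣ x · w

Orthogonal-isSubspace : ∀ p (w : Vecₚ n) → IsSubspace p (Orthogonal p w)
Orthogonal-isSubspace {n} p w = record
  { resp = λ x≈y p∣x·w → Cong-resp-∣ (·-cong-≈ w x≈y) p∣x·w
  ; has0 = subst (p ∣_) (sym (sum-replicate-zero n)) (p ∣0)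
  ; closed+ = λ {x} {y} p∣x·w p∣y·w → subst (p ∣_) (sym (·-distribʳ-+V x y w)) (∣m∣n⇒∣m+n p∣x·w p∣y·w)
  ; closed· = λ c {x} p∣x·w → subst (p ∣_) (sym (·V-· c x w)) (∣n⇒∣m*n c p∣x·w)
  }

1*a+0≡a : ∀ a → 1 * a + 0 ≡ a
1*a+0≡a a = trans (+-identityʳ (1 * a)) (*-identityˡ a)

module _ {p : ℕ} where

  0∈Span : ∀ (gens : List (Vecₚ n)) → Span p gens zeroV
  0∈Span [] = [] , refl , λ i → Cong-refl
  0∈Span (g ∷ gs) with 0∈Span gs
  ... | cs , cs-length , 0≈ = 0 ∷ cs , cong suc cs-length , 0≈

  ∈-Span : ∀ {gens : List (Vecₚ n)} {g} → g ∈ˡ gens → Span p gens g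
  ∈-Span {gens = g ∷ gs} (here refl) with 0∈Span gs
  ... | cs , cs-length , 0≈ = 1 ∷ cs , cong suc cs-length ,
        λ i → Cong-trans (≡⇒Cong (sym (1*a+0≡a (g i)))) (Cong-+ Cong-refl (0≈ i))
  ∈-Span {gens = _ ∷ gs} (there g∈gs) with ∈-Span g∈gs
  ... | cs , cs-length , g≈ = 0 ∷ cs , cong suc cs-length , g≈

  Span-⊆ : ∀ {P : Code n} {gens} → IsSubspace p P → (∀ {g} → g ∈ˡ gens → P g) →
           ∀ {x} → Span p gens x → P x
  Span-⊆ {gens = []} P-sub _ ([] , _ , x≈0) = resp (≈-sym x≈0) has0
    where open IsSubspace P-sub
  Span-⊆ {gens = g ∷ gs} P-sub gens⊆P (c ∷ cs , cs-length , x≈) =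
    resp (≈-sym x≈) (closed+ (closed· c (gens⊆P (here refl)))
                              (Span-⊆ P-sub (gens⊆P ∘ there) (cs , suc-injective cs-length , λ i → Cong-refl)))
    where open IsSubspace P-sub

  ⊙∈·C : ∀ {C D : Code n} {u v x} → C u → D v → x ≈[ p ] (u ⊙ v) → (C ·C D) p x
  ⊙∈·C {u = u} {v} C∋u D∋v x≈u⊙v =
    (1 , u , v) ∷ [] , (C∋u , D∋v) ListAll.∷ ListAll.[] ,
    λ i → Cong-trans (x≈u⊙v i) (≡⇒Cong (sym (1*a+0≡a (u i * v i))))

  ·C-⊆ : ∀ {P C D : Code n} → IsSubspace p P → (∀ {u v} → C u → D v → P (u ⊙ v)) →
         ∀ {x} → (C ·C D) p x → P x
  ·C-⊆ {n} {P} {C} {D} P-sub ⊙⊆P (ts , ts⊆ , x≈) = resp (≈-sym x≈) (sumProd∈ (λ CD → CD) ts ts⊆)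
    where
    open IsSubspace P-sub
    sumProd∈ : ∀ {Q : ℕ × Vecₚ n × Vecₚ n → Set} → (∀ {c u v} → Q (c , u , v) → C u × D v) →
               ∀ ts → ListAll.All Q ts → P (sumProd ts)
    sumProd∈ _ [] ListAll.[] = has0
    sumProd∈ Q⇒CD ((c , u , v) ∷ ts) (q ListAll.∷ qs) with Q⇒CD q
    ... | C∋u , D∋v = closed+ (closed· c (⊙⊆P C∋u D∋v)) (sumProd∈ Q⇒CD ts qs)

  vanishes-outside-support : ∀ {D : Code n} {v} i → D v → ¬ InSupport p D i → Cong p (v i) 0
  vanishes-outside-support {v = v} i D∋v i∉supp with p ∣? v i
  ... | yes p∣vᵢ = ∣⇒Cong0 p∣vᵢ
  ... | no p∤vᵢ = contradiction (v , D∋v , λ vᵢ≈0 → p∤vᵢ (Cong-resp-∣ (Cong-sym vᵢ≈0) (p ∣0))) i∉supp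

  DirectSum-swap : ∀ {W C₁ C₂ : Code n} → DirectSum p W C₁ C₂ → DirectSum p W C₂ C₁
  DirectSum-swap W=C₁⊕C₂ = record
    { sub₁ = sub₂
    ; sub₂ = sub₁
    ; decomp = λ W∋x → let a , b , C₁∋a , C₂∋b , x≈a+b = decomp W∋x in
        b , a , C₂∋b , C₁∋a , λ i → Cong-trans (x≈a+b i) (≡⇒Cong (+-comm (a i) (b i)))
    ; trivial∩ = λ C₂∋x C₁∋x → trivial∩ C₁∋x C₂∋x
    }
    where open DirectSum W=C₁⊕C₂

  -- The witness is the C₁-component of x; on S it agrees with x because the C₂-component vanishes there.
  DirectSum-component-restriction : ∀ {W C₁ C₂ : Code n} {S : Subset n} → DirectSum p W C₁ C₂ →
    (∀ i → InSupport p C₁ i → i ∈ S) → (∀ i → InSupport p C₂ i → i ∉ S) →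
    ∀ {x} → W x → ∃ λ a → C₁ a × a ≈[ p ] (x ⊙ χ S)
  DirectSum-component-restriction {S = S} W=C₁⊕C₂ supp₁⊆S supp₂∩S=∅ {x} W∋x
    with DirectSum.decomp W=C₁⊕C₂ W∋x
  ... | a , b , C₁∋a , C₂∋b , x≈a+b = a , C₁∋a , a≈x⊙χS
    where
    open SetoidReasoning (Cong-setoid p)
    a≈x⊙χS : a ≈[ p ] (x ⊙ χ S)
    a≈x⊙χS i with i ∈? S
    ... | yes i∈S = begin
      a i          ≡⟨ +-identityʳ (a i) ⟨
      a i + 0      ≈⟨ Cong-+ Cong-refl (vanishes-outside-support i C₂∋b (λ i∈C₂ → supp₂∩S=∅ i i∈C₂ i∈S)) ⟨
      a i + b i    ≈⟨ x≈a+b i ⟨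
      x i          ≡⟨ *-identityʳ (x i) ⟨
      x i * 1      ≡⟨ cong (x i *_) (χ-∈ i∈S) ⟨
      x i * χ S i  ∎
    ... | no i∉S = begin
      a i          ≈⟨ vanishes-outside-support i C₁∋a (i∉S ∘ supp₁⊆S i) ⟩
      0            ≡⟨ *-zeroʳ (x i) ⟨
      x i * 0      ≡⟨ cong (x i *_) (χ-∉ i∉S) ⟨
      x i * χ S i  ∎

module _ {n : ℕ} (p : ℕ) (𝓕 : Family n) where

  private
    V : Code n
    V = charSpan p 𝓕

  χ∈charSpan : ∀ {F} → F ∈ˡ 𝓕 → V (χ F)
  χ∈charSpan F∈𝓕 = ∈-Span (∈-map⁺ χ F∈𝓕)

  charSpan-⊆ : ∀ {P : Code n} → IsSubspace p P → (∀ {F} → F ∈ˡ 𝓕 → P (χ F)) → ∀ {x} → V x → P x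
  charSpan-⊆ {P} P-sub χ⊆P = Span-⊆ P-sub χF∈P
    where
    χF∈P : ∀ {g} → g ∈ˡ List.map χ 𝓕 → P g
    χF∈P g∈ with ∈-map⁻ χ g∈
    ... | F , F∈𝓕 , refl = χ⊆P F∈𝓕

  χ⋂∈Pow : ∀ {j} (Fs : Vec (Subset n) (suc j)) → VecAll.All (_∈ˡ 𝓕) Fs → Pow p V (suc j) (χ (⋂ Fs))
  χ⋂∈Pow (F ∷ []) (F∈𝓕 VecAll.∷ VecAll.[]) = subst (V ∘ χ) (sym (∩-identityʳ F)) (χ∈charSpan F∈𝓕)
  χ⋂∈Pow (F ∷ G ∷ Fs) (F∈𝓕 VecAll.∷ Fs∈𝓕) =
    ⊙∈·C (χ⋂∈Pow (G ∷ Fs) Fs∈𝓕) (χ∈charSpan F∈𝓕)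
         (λ i → ≡⇒Cong (trans (χ-∩ F (⋂ (G ∷ Fs)) i) (*-comm (χ F i) _)))

  Pow-orthogonal-⋂ : ∀ j {m} → KWiseDivisible (suc j + m) p 𝓕 → ∀ {x} → Pow p V (suc j) x →
    (Fs : Vec (Subset n) m) → VecAll.All (_∈ˡ 𝓕) Fs → Orthogonal p (χ (⋂ Fs)) x
  Pow-orthogonal-⋂ zero kw V∋x Fs Fs∈𝓕 = charSpan-⊆ (Orthogonal-isSubspace p _) χ⊥ V∋x
    where
    χ⊥ : ∀ {F} → F ∈ˡ 𝓕 → Orthogonal p (χ (⋂ Fs)) (χ F)
    χ⊥ {F} F∈𝓕 = subst (p ∣_) (sym (χ-·-χ F (⋂ Fs))) (kw (F ∷ Fs) (F∈𝓕 VecAll.∷ Fs∈𝓕))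
  Pow-orthogonal-⋂ (suc j) {m} kw Pow∋x Fs Fs∈𝓕 = ·C-⊆ (Orthogonal-isSubspace p w) ⊙⊥ Pow∋x
    where
    w = χ (⋂ Fs)
    kw′ : KWiseDivisible (suc j + suc m) p 𝓕
    kw′ = subst (λ k → KWiseDivisible k p 𝓕) (cong suc (sym (+-suc j m))) kw
    -- v ↦ u ⊙ v is self-adjoint, so it suffices that v is orthogonal to u ⊙ w.
    ⊙⊥ : ∀ {u v} → Pow p V (suc j) u → V v → Orthogonal p w (u ⊙ v)
    ⊙⊥ {u} {v} Pow∋u V∋v =
      subst (p ∣_) (sym (⊙-·-swap u v w)) (charSpan-⊆ (Orthogonal-isSubspace p (u ⊙ w)) χ⊥ V∋v)
      where
      χ⊥ : ∀ {F} → F ∈ˡ 𝓕 → Orthogonal p (u ⊙ w) (χ F)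
      χ⊥ {F} F∈𝓕 = subst (p ∣_) (sym (trans (·-⊙-swap (χ F) u w) (·-congʳ u (sym ∘ χ-∩ F (⋂ Fs)))))
                          (Pow-orthogonal-⋂ j kw′ Pow∋u (F ∷ Fs) (F∈𝓕 VecAll.∷ Fs∈𝓕))

  Pow⇒p∣sum : ∀ {k} → 1 ≤ k → KWiseDivisible k p 𝓕 → ∀ {x} → Pow p V k x → p ∣ sum x
  Pow⇒p∣sum {suc j} (s≤s z≤n) kw {x} Pow∋x =
    subst (p ∣_) (·-χ⊤ x) (Pow-orthogonal-⋂ j kw′ Pow∋x [] VecAll.[])
    where
    kw′ : KWiseDivisible (suc j + 0) p 𝓕
    kw′ = subst (λ k → KWiseDivisible k p 𝓕) (sym (+-identityʳ (suc j))) kw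

  component-KWiseDivisible : ∀ {k} {C₁ C₂ : Code n} (S : Subset n) → 1 ≤ k → KWiseDivisible k p 𝓕 →
    DirectSum p (Pow p V k) C₁ C₂ →
    (∀ i → InSupport p C₁ i → i ∈ S) → (∀ i → InSupport p C₂ i → i ∉ S) →
    KWiseDivisible k p (restrict 𝓕 S)
  component-KWiseDivisible {suc j} S 1≤k kw W=C₁⊕C₂ supp₁⊆S supp₂∩S=∅ =
    KWiseDivisible-restrict 𝓕 S 1≤k meets
    where
    meets : ∀ (Fs : Vec (Subset n) (suc j)) → VecAll.All (_∈ˡ 𝓕) Fs → p ∣ ∣ ⋂ Fs ∩ S ∣
    meets Fs Fs∈𝓕 with DirectSum-component-restriction W=C₁⊕C₂ supp₁⊆S supp₂∩S=∅ (χ⋂∈Pow Fs Fs∈𝓕)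
    ... | a , C₁∋a , a≈ = subst (p ∣_) (χ-·-χ (⋂ Fs) S)
                            (Cong-resp-∣ (sum-Cong a≈) (Pow⇒p∣sum 1≤k kw (DirectSum.sub₁ W=C₁⊕C₂ C₁∋a)))

∈-─⁺ : ∀ {A : Set} {x y : A} {xs} (x∈xs : x ∈ˡ xs) → y ∈ˡ xs → y ≢ x → y ∈ˡ xs ─ˡ x∈xs
∈-─⁺ (here refl) (here refl) y≢x = contradiction refl y≢x
∈-─⁺ (here refl) (there y∈xs) _ = y∈xs
∈-─⁺ (there x∈xs) (here refl) _ = here refl
∈-─⁺ (there x∈xs) (there y∈xs) y≢x = there (∈-─⁺ x∈xs y∈xs y≢x)

unique⊆⇒length≤ : ∀ {A : Set} {xs ys : List A} → Unique xs → (∀ {z} → z ∈ˡ xs → z ∈ˡ ys) → length xs ≤ length ys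
unique⊆⇒length≤ {xs = []} _ _ = z≤n
unique⊆⇒length≤ {xs = x ∷ xs} {ys} (x≢xs ∷ xs!) xs⊆ys = begin
  suc (length xs)               ≤⟨ s≤s (unique⊆⇒length≤ xs! xs⊆ys─x) ⟩
  suc (length (ys ─ˡ x∈ys))     ≡⟨ length-removeAt′ ys (index x∈ys) ⟨
  length ys                     ∎
  where
  open ≤-Reasoning
  x∈ys = xs⊆ys (here refl)
  xs⊆ys─x : ∀ {z} → z ∈ˡ xs → z ∈ˡ ys ─ˡ x∈ys
  xs⊆ys─x z∈xs = ∈-─⁺ x∈ys (xs⊆ys (there z∈xs)) (λ z≡x → ListAll.lookup x≢xs z∈xs (sym z≡x))

length-cartesianProduct : ∀ {A B : Set} (xs : List A) (ys : List B) →
  length (cartesianProduct xs ys) ≡ length xs * length ys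
length-cartesianProduct [] ys = refl
length-cartesianProduct (x ∷ xs) ys = begin
  length (List.map (x ,_) ys List.++ cartesianProduct xs ys)   ≡⟨ length-++ (List.map (x ,_) ys) ⟩
  length (List.map (x ,_) ys) + length (cartesianProduct xs ys)
    ≡⟨ cong₂ _+_ (length-map (x ,_) ys) (length-cartesianProduct xs ys) ⟩
  length ys + length xs * length ys                             ∎
  where open ≡-Reasoning

∩-split-injective : ∀ {S₁ S₂ : Subset n} → S₁ ∪ S₂ ≡ ⊤ → ∀ {F G} →
  F ∩ S₁ ≡ G ∩ S₁ → F ∩ S₂ ≡ G ∩ S₂ → F ≡ G
∩-split-injective {S₁ = S₁} {S₂} S₁∪S₂≡⊤ {F} {G} eq₁ eq₂ = begin
  F                       ≡⟨ ∩-identityʳ F ⟨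
  F ∩ ⊤                   ≡⟨ cong (F ∩_) S₁∪S₂≡⊤ ⟨
  F ∩ (S₁ ∪ S₂)           ≡⟨ ∩-distribˡ-∪ F S₁ S₂ ⟩
  (F ∩ S₁) ∪ (F ∩ S₂)     ≡⟨ cong₂ _∪_ eq₁ eq₂ ⟩
  (G ∩ S₁) ∪ (G ∩ S₂)     ≡⟨ ∩-distribˡ-∪ G S₁ S₂ ⟨
  G ∩ (S₁ ∪ S₂)           ≡⟨ cong (G ∩_) S₁∪S₂≡⊤ ⟩
  G ∩ ⊤                   ≡⟨ ∩-identityʳ G ⟩
  G                       ∎
  where open ≡-Reasoning

card-≤-restrict-* : ∀ (𝓕 : Family n) (S₁ S₂ : Subset n) → (∀ i → i ∈ S₁ ⊎ i ∈ S₂) →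
  card 𝓕 ≤ card (restrict 𝓕 S₁) * card (restrict 𝓕 S₂)
card-≤-restrict-* 𝓕 S₁ S₂ cover = begin
  card 𝓕                                        ≡⟨ length-map split D ⟨
  length (List.map split D)                     ≤⟨ unique⊆⇒length≤ split[D]! split∈D₁×D₂ ⟩
  length (cartesianProduct D₁ D₂)               ≡⟨ length-cartesianProduct D₁ D₂ ⟩
  card (restrict 𝓕 S₁) * card (restrict 𝓕 S₂)  ∎
  where
  open ≤-Reasoning
  _≟_ = VecProperties.≡-dec Bool._≟_
  D = deduplicate _≟_ 𝓕
  D₁ = deduplicate _≟_ (restrict 𝓕 S₁)
  D₂ = deduplicate _≟_ (restrict 𝓕 S₂)

  split : Subset _ → Subset _ × Subset _
  split F = F ∩ S₁ , F ∩ S₂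

  split[D]! : Unique (List.map split D)
  split[D]! = Unique.map⁺ (λ eq → ∩-split-injective S₁∪S₂≡⊤ (cong proj₁ eq) (cong proj₂ eq))
                          (deduplicate-! _≟_ 𝓕)
    where
    S₁∪S₂≡⊤ : S₁ ∪ S₂ ≡ ⊤
    S₁∪S₂≡⊤ = ⊆-antisym ⊆⊤ (λ {i} _ → [ p⊆p∪q S₂ , q⊆p∪q S₁ S₂ ] (cover i))

  split∈D₁×D₂ : ∀ {z} → z ∈ˡ List.map split D → z ∈ˡ cartesianProduct D₁ D₂
  split∈D₁×D₂ z∈ with ∈-map⁻ split z∈
  ... | F , F∈D , refl = ∈-cartesianProduct⁺ (∈-deduplicate⁺ _≟_ (∈-map⁺ (_∩ S₁) F∈𝓕))
                                             (∈-deduplicate⁺ _≟_ (∈-map⁺ (_∩ S₂) F∈𝓕))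
    where F∈𝓕 = ∈-deduplicate⁻ _≟_ 𝓕 F∈D

lemma3p6 : ∀ {n : ℕ} (k p : ℕ) (𝓕 : Family n) (C₁ C₂ : Code n) (S₁ S₂ : Subset n) →
    1 ≤ k → Prime p →
    FullSupport 𝓕 → KWiseDivisible k p 𝓕 →
    IsSubspace p C₁ → IsSubspace p C₂ →
    DirectSum p (Pow p (charSpan p 𝓕) k) C₁ C₂ →
    (∀ i → (i ∈ S₁) ⇔ InSupport p C₁ i) →
    (∀ i → (i ∈ S₂) ⇔ InSupport p C₂ i) →
    (∀ i → i ∈ S₁ → i ∉ S₂) →
    ∃ (λ i → i ∈ S₁) → ∃ (λ i → i ∈ S₂) →
    (∀ i → i ∈ S₁ ⊎ i ∈ S₂) →
    KWiseDivisible k p (restrict 𝓕 S₁) × KWiseDivisible k p (restrict 𝓕 S₂) ×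
      card 𝓕 ≤ card (restrict 𝓕 S₁) * card (restrict 𝓕 S₂)
lemma3p6 k p 𝓕 C₁ C₂ S₁ S₂ 1≤k _ _ kw _ _ W=C₁⊕C₂ S₁⇔supp₁ S₂⇔supp₂ disjoint _ _ cover =
  component-KWiseDivisible p 𝓕 S₁ 1≤k kw W=C₁⊕C₂ supp₁⊆S₁
    (λ i i∈supp₂ i∈S₁ → disjoint i i∈S₁ (supp₂⊆S₂ i i∈supp₂)) ,
  component-KWiseDivisible p 𝓕 S₂ 1≤k kw (DirectSum-swap W=C₁⊕C₂) supp₂⊆S₂
    (λ i i∈supp₁ → disjoint i (supp₁⊆S₁ i i∈supp₁)) ,
  card-≤-restrict-* 𝓕 S₁ S₂ cover
  where
  supp₁⊆S₁ = λ i → Equivalence.from (S₁⇔supp₁ i)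
  supp₂⊆S₂ = λ i → Equivalence.from (S₂⇔supp₂ i)
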